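{- Let $X \subseteq \omega$ and let $\mathcal{A}$ be a pca with a strongly $X$-effectively pca-valued partial numbering $\gamma$. Then $\mathcal{A}$ embeds in $\mathcal{K}_2^X$, and hence in $\mathcal{K}_2$.
   Context: A pca is a set with a partial binary application containing distinct $\mathrm{s},\mathrm{k}$ with $\mathrm{k}ab = a$, $\mathrm{s}ab$ defined, and $\mathrm{s}abc \simeq (ac)(bc)$. A partial numbering is a surjective partial function $\gamma : \omega \rightharpoonup \mathcal{A}$. $\gamma$ is $X$-effectively pca-valued if there is a partial $X$-computable $\psi$ such that for all $n,m \in \mathrm{dom}(\gamma)$, if $\gamma(n)\gamma(m)$ is defined then $\psi(n,m)$ is defined and $\gamma(n)\gamma(m) = \gamma(\psi(n,m))$; it is strongly $X$-effectively pca-valued if moreover such $\psi$ can be chosen so that for all $n,m,k,l \in \mathrm{dom}(\gamma)$, if $\gamma(n)\gamma(m)$ and $\gamma(k)\gamma(l)$ are both defined and equal, then $\psi(n,m) = \psi(k,l)$. An embedding is an injective map $f$ such that whenever $ab$ is defined, $f(a)f(b)$ is defined and equals $f(ab)$. $\mathcal{K}_2$ is the pca of total functions $\omega\to\omega$ with $g \cdot h = \Phi^{g \oplus h}_{g(0)}$, defined iff total ($\Phi_e$ the $e$-th Turing functional, $(g\oplus h)(2n)=g(n)$, $(g\oplus h)(2n+1)=h(n)$); $\mathcal{K}_2^X$ is its sub-pca of $X$-computable functions. -}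

module Defs where

open import Data.Nat using (ℕ; zero; suc; _+_; _<_)
open import Data.Bool using (Bool; true; false)
open import Data.Product using (Σ; ∃; _×_; _,_)
open import Relation.Binary.PropositionalEquality using (_≡_; _≢_)
open import Function.Bundles using (_⇔_)

triangle : ℕ → ℕ
triangle zero    = zero
triangle (suc n) = suc n + triangle n

⟨_,_⟩ : ℕ → ℕ → ℕ
⟨ a , b ⟩ = triangle (a + b) + b

-- Oracle partial recursive functions (unary, via pairing).

data Code : Set where
  Z S Fst Snd Orc : Code
  comp pr prec    : Code → Code → Code
  mu              : Code → Code

data Eval (o : ℕ → ℕ) : Code → ℕ → ℕ → Set where
  evZ    : ∀ {x} → Eval o Z x 0
  evS    : ∀ {x} → Eval o S x (suc x)
  evFst  : ∀ {a b} → Eval o Fst ⟨ a , b ⟩ a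
  evSnd  : ∀ {a b} → Eval o Snd ⟨ a , b ⟩ b
  evOrc  : ∀ {x} → Eval o Orc x (o x)
  evComp : ∀ {f g x y z} → Eval o g x y → Eval o f y z → Eval o (comp f g) x z
  evPr   : ∀ {f g x y z} → Eval o f x y → Eval o g x z → Eval o (pr f g) x ⟨ y , z ⟩
  evRec0 : ∀ {f g x y} → Eval o f x y → Eval o (prec f g) ⟨ x , 0 ⟩ y
  evRecS : ∀ {f g x n y z} → Eval o (prec f g) ⟨ x , n ⟩ y →
           Eval o g ⟨ x , ⟨ n , y ⟩ ⟩ z → Eval o (prec f g) ⟨ x , suc n ⟩ z
  evMu   : ∀ {f x y} → Eval o f ⟨ x , y ⟩ 0 →
           (∀ z → z < y → ∃ λ k → Eval o f ⟨ x , z ⟩ (suc k)) →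
           Eval o (mu f) x y

data Codes : ℕ → Code → Set where
  cZ    : Codes ⟨ 0 , 0 ⟩ Z
  cS    : Codes ⟨ 1 , 0 ⟩ S
  cFst  : Codes ⟨ 2 , 0 ⟩ Fst
  cSnd  : Codes ⟨ 3 , 0 ⟩ Snd
  cOrc  : Codes ⟨ 4 , 0 ⟩ Orc
  cComp : ∀ {i j f g} → Codes i f → Codes j g → Codes ⟨ 5 , ⟨ i , j ⟩ ⟩ (comp f g)
  cPr   : ∀ {i j f g} → Codes i f → Codes j g → Codes ⟨ 6 , ⟨ i , j ⟩ ⟩ (pr f g)
  cPrec : ∀ {i j f g} → Codes i f → Codes j g → Codes ⟨ 7 , ⟨ i , j ⟩ ⟩ (prec f g)
  cMu   : ∀ {i f} → Codes i f → Codes ⟨ 8 , i ⟩ (mu f)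

Φ : ℕ → (ℕ → ℕ) → ℕ → ℕ → Set
Φ e o x y = Σ Code λ c → Codes e c × Eval o c x y

χ : (ℕ → Bool) → ℕ → ℕ
χ X n with X n
... | true  = 1
... | false = 0

IsComputableIn : (ℕ → Bool) → (ℕ → ℕ) → Set
IsComputableIn X g = ∃ λ e → ∀ n → Φ e (χ X) n (g n)

_⊕_ : (ℕ → ℕ) → (ℕ → ℕ) → ℕ → ℕ
(g ⊕ h) zero          = g 0
(g ⊕ h) (suc zero)    = h 0
(g ⊕ h) (suc (suc n)) = ((λ i → g (suc i)) ⊕ (λ i → h (suc i))) n

K₂App : (ℕ → ℕ) → (ℕ → ℕ) → (ℕ → ℕ) → Set
K₂App g h k = ∀ n → Φ (g 0) (g ⊕ h) n (k n)

record PCA : Set₁ where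
  field
    Carrier    : Set
    _·_↓_      : Carrier → Carrier → Carrier → Set
    functional : ∀ {a b c c'} → a · b ↓ c → a · b ↓ c' → c ≡ c'
    s k        : Carrier
    s≢k        : s ≢ k
    k-ax       : ∀ a b → ∃ λ ka → (k · a ↓ ka) × (ka · b ↓ a)
    s-def      : ∀ a b → ∃ λ sa → ∃ λ sab → (s · a ↓ sa) × (sa · b ↓ sab)
    s-ax       : ∀ a b c sa sab d → s · a ↓ sa → sa · b ↓ sab →
                 (sab · c ↓ d ⇔
                  (∃ λ u → ∃ λ v → (a · c ↓ u) × (b · c ↓ v) × (u · v ↓ d)))

record PartialNumbering (A : PCA) : Set₁ where
  open PCA A
  field
    γ          : ℕ → Carrier → Set
    functional : ∀ {n a b} → γ n a → γ n b → a ≡ b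
    surjective : ∀ a → ∃ λ n → γ n a

-- ψ given as the partial X-computable function ψ(n,m) ≃ Φ_e^X(⟨n,m⟩)
StronglyEffectivelyPCAValued : (X : ℕ → Bool) (A : PCA) → PartialNumbering A → Set
StronglyEffectivelyPCAValued X A N =
  ∃ λ e →
    (∀ n m a b c → γ n a → γ m b → a · b ↓ c →
       ∃ λ y → Φ e (χ X) ⟨ n , m ⟩ y × γ y c)
  × (∀ n m n' m' a b a' b' c y y' →
       γ n a → γ m b → γ n' a' → γ m' b' → a · b ↓ c → a' · b' ↓ c →
       Φ e (χ X) ⟨ n , m ⟩ y → Φ e (χ X) ⟨ n' , m' ⟩ y' → y ≡ y')
  where open PCA A
        open PartialNumbering N using (γ)

IsEmbeddingK₂ : (A : PCA) → (PCA.Carrier A → ℕ → ℕ) → Set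
IsEmbeddingK₂ A f =
  (∀ a b → (∀ n → f a n ≡ f b n) → a ≡ b)
  × (∀ a b c → a · b ↓ c → K₂App (f a) (f b) (f c))
  where open PCA A

EmbedsInK₂ : PCA → Set
EmbedsInK₂ A = Σ (PCA.Carrier A → ℕ → ℕ) λ f → IsEmbeddingK₂ A f

EmbedsInK₂^ : (ℕ → Bool) → PCA → Set
EmbedsInK₂^ X A = Σ (PCA.Carrier A → ℕ → ℕ) λ f →
  (∀ a → IsComputableIn X (f a)) × IsEmbeddingK₂ A f

-- Fix a canonical name for every element: by strong effectivity, ψ(n, m) depends
-- only on the value γ(n)γ(m), so every c = (k c) c gets the canonical name
-- canon c := ψ(name (k c), name c), and ψ maps canonical names of a, b to the
-- canonical name of ab.  Send a to the sequence
--   e*, ⟨canon a, X(0)⟩, ⟨canon a, X(1)⟩, …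
-- where e* is a single program that, given the oracle g ⊕ h for such sequences g
-- and h, reads off the canonical names and X, runs ψ relative to X and prints the
-- sequence of the result.  The map is X-computable, injective since γ is
-- functional, and turns application in the pca into application in K₂.
module Submission where

open import Defs
open import Data.Nat using (ℕ; zero; suc; _+_; _<_; _≤_; z≤n; s≤s)
open import Data.Nat.Properties
open import Data.Bool using (Bool)
open import Data.Product using (∃; ∃₂; _×_; _,_; proj₁; proj₂; uncurry)
open import Data.Empty using (⊥-elim)
open import Relation.Binary.PropositionalEquality
open import Relation.Binary using (tri<; tri≈; tri>)

triangle-mono-≤ : ∀ {s t} → s ≤ t → triangle s ≤ triangle t
triangle-mono-≤ {zero}  _         = z≤n
triangle-mono-≤ {suc s} (s≤s s≤t) = +-mono-≤ (s≤s s≤t) (triangle-mono-≤ s≤t)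

pair<triangle-suc : ∀ a b → ⟨ a , b ⟩ < triangle (suc (a + b))
pair<triangle-suc a b = subst (⟨ a , b ⟩ <_) (+-comm (triangle (a + b)) (suc (a + b)))
  (+-monoʳ-< (triangle (a + b)) (s≤s (m≤n+m b a)))

pair-mono-< : ∀ a b a' b' → a + b < a' + b' → ⟨ a , b ⟩ < ⟨ a' , b' ⟩
pair-mono-< a b a' b' lt = begin-strict
  ⟨ a , b ⟩                 <⟨ pair<triangle-suc a b ⟩
  triangle (suc (a + b))   ≤⟨ triangle-mono-≤ lt ⟩
  triangle (a' + b')       ≤⟨ m≤m+n _ b' ⟩
  ⟨ a' , b' ⟩               ∎
  where open ≤-Reasoning

pair-injective : ∀ {a b a' b'} → ⟨ a , b ⟩ ≡ ⟨ a' , b' ⟩ → a ≡ a' × b ≡ b'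
pair-injective {a} {b} {a'} {b'} eq with <-cmp (a + b) (a' + b')
... | tri< lt _ _ = ⊥-elim (<-irrefl eq (pair-mono-< a b a' b' lt))
... | tri> _ _ gt = ⊥-elim (<-irrefl (sym eq) (pair-mono-< a' b' a b gt))
... | tri≈ _ s≡s' _ = a≡a' , b≡b'
  where
  b≡b' : b ≡ b'
  b≡b' = +-cancelˡ-≡ (triangle (a + b)) b b' (trans eq (cong (λ t → triangle t + b') (sym s≡s')))
  a≡a' : a ≡ a'
  a≡a' = +-cancelʳ-≡ b a a' (trans s≡s' (cong (a' +_) (sym b≡b')))

pair-surjective : ∀ n → ∃₂ λ a b → ⟨ a , b ⟩ ≡ n
pair-surjective zero = 0 , 0 , refl
pair-surjective (suc n) with pair-surjective n
... | zero , b , refl = suc b , 0 , (begin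
  triangle (suc b + 0) + 0 ≡⟨ +-identityʳ _ ⟩
  triangle (suc b + 0)     ≡⟨ cong (λ t → triangle (suc t)) (+-identityʳ b) ⟩
  suc (b + triangle b)     ≡⟨ cong suc (+-comm b (triangle b)) ⟩
  suc ⟨ 0 , b ⟩             ∎)
  where open ≡-Reasoning
... | suc a , b , refl = a , suc b ,
  trans (cong (λ t → triangle t + suc b) (+-suc a b)) (+-suc _ b)

tag : Code → ℕ
tag Z          = 0
tag S          = 1
tag Fst        = 2
tag Snd        = 3
tag Orc        = 4
tag (comp _ _) = 5
tag (pr _ _)   = 6
tag (prec _ _) = 7
tag (mu _)     = 8

mutual
  codeOf : Code → ℕ
  codeOf c = ⟨ tag c , body c ⟩

  body : Code → ℕ
  body (comp f g) = ⟨ codeOf f , codeOf g ⟩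
  body (pr f g)   = ⟨ codeOf f , codeOf g ⟩
  body (prec f g) = ⟨ codeOf f , codeOf g ⟩
  body (mu f)     = codeOf f
  body _          = 0

Codes-codeOf : ∀ c → Codes (codeOf c) c
Codes-codeOf Z          = cZ
Codes-codeOf S          = cS
Codes-codeOf Fst        = cFst
Codes-codeOf Snd        = cSnd
Codes-codeOf Orc        = cOrc
Codes-codeOf (comp f g) = cComp (Codes-codeOf f) (Codes-codeOf g)
Codes-codeOf (pr f g)   = cPr (Codes-codeOf f) (Codes-codeOf g)
Codes-codeOf (prec f g) = cPrec (Codes-codeOf f) (Codes-codeOf g)
Codes-codeOf (mu f)     = cMu (Codes-codeOf f)

Codes⇒≡codeOf : ∀ {e c} → Codes e c → e ≡ codeOf c
Codes⇒≡codeOf cZ          = refl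
Codes⇒≡codeOf cS          = refl
Codes⇒≡codeOf cFst        = refl
Codes⇒≡codeOf cSnd        = refl
Codes⇒≡codeOf cOrc        = refl
Codes⇒≡codeOf (cComp p q) = cong (λ n → ⟨ 5 , n ⟩) (cong₂ ⟨_,_⟩ (Codes⇒≡codeOf p) (Codes⇒≡codeOf q))
Codes⇒≡codeOf (cPr p q)   = cong (λ n → ⟨ 6 , n ⟩) (cong₂ ⟨_,_⟩ (Codes⇒≡codeOf p) (Codes⇒≡codeOf q))
Codes⇒≡codeOf (cPrec p q) = cong (λ n → ⟨ 7 , n ⟩) (cong₂ ⟨_,_⟩ (Codes⇒≡codeOf p) (Codes⇒≡codeOf q))
Codes⇒≡codeOf (cMu p)     = cong (λ n → ⟨ 8 , n ⟩) (Codes⇒≡codeOf p)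

mutual
  codeOf-injective : ∀ c c' → codeOf c ≡ codeOf c' → c ≡ c'
  codeOf-injective c c' eq with pair-injective {tag c} {body c} {tag c'} {body c'} eq
  ... | tag≡ , body≡ = tag-body-injective c c' tag≡ body≡

  -- programs with different tags need no clause: the refl pattern rules them out
  tag-body-injective : ∀ c c' → tag c ≡ tag c' → body c ≡ body c' → c ≡ c'
  tag-body-injective Z          Z            refl _  = refl
  tag-body-injective S          S            refl _  = refl
  tag-body-injective Fst        Fst          refl _  = refl
  tag-body-injective Snd        Snd          refl _  = refl
  tag-body-injective Orc        Orc          refl _  = refl
  tag-body-injective (comp f g) (comp f' g') refl eq = uncurry (cong₂ comp) (codeOf-pair-injective f g f' g' eq)
  tag-body-injective (pr f g)   (pr f' g')   refl eq = uncurry (cong₂ pr) (codeOf-pair-injective f g f' g' eq)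
  tag-body-injective (prec f g) (prec f' g') refl eq = uncurry (cong₂ prec) (codeOf-pair-injective f g f' g' eq)
  tag-body-injective (mu f)     (mu f')      refl eq = cong mu (codeOf-injective f f' eq)

  codeOf-pair-injective : ∀ f g f' g' → ⟨ codeOf f , codeOf g ⟩ ≡ ⟨ codeOf f' , codeOf g' ⟩ →
                          f ≡ f' × g ≡ g'
  codeOf-pair-injective f g f' g' eq with pair-injective {codeOf f} {codeOf g} {codeOf f'} {codeOf g'} eq
  ... | f≡f' , g≡g' = codeOf-injective f f' f≡f' , codeOf-injective g g' g≡g'

Codes-functional : ∀ {e c c'} → Codes e c → Codes e c' → c ≡ c'
Codes-functional {c = c} {c'} p q =
  codeOf-injective c c' (trans (sym (Codes⇒≡codeOf p)) (Codes⇒≡codeOf q))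

idP : Code
idP = pr Fst Snd

addP : Code
addP = prec idP (comp S (comp Snd Snd))

doubleP : Code
doubleP = comp addP (pr idP idP)

constP : ℕ → Code
constP zero    = Z
constP (suc m) = comp S (constP m)

-- consP h t computes n ↦ h(0) if n = 0, and t(n - 1) otherwise
consP : Code → Code → Code
consP h t = comp (prec h (comp t (comp Fst Snd))) (pr Z idP)

module _ {o : ℕ → ℕ} where

  eval-id : ∀ n → Eval o idP n n
  eval-id n with pair-surjective n
  ... | a , b , refl = evPr (evFst {a = a} {b}) (evSnd {a = a} {b})

  eval-add : ∀ x y → Eval o addP ⟨ x , y ⟩ (x + y)
  eval-add x zero    = evRec0 {x = x} (subst (Eval o idP x) (sym (+-identityʳ x)) (eval-id x))
  eval-add x (suc y) = evRecS {x = x} {y} (eval-add x y)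
    (subst (Eval o _ _) (sym (+-suc x y))
      (evComp (evComp (evSnd {a = x} {⟨ y , x + y ⟩}) (evSnd {a = y} {x + y})) evS))

  eval-double : ∀ n → Eval o doubleP n (n + n)
  eval-double n = evComp (evPr (eval-id n) (eval-id n)) (eval-add n n)

  eval-const : ∀ m x → Eval o (constP m) x m
  eval-const zero    x = evZ
  eval-const (suc m) x = evComp (eval-const m x) evS

  eval-cons : ∀ {h t} (u : ℕ → ℕ) → Eval o h 0 (u 0) → (∀ n → Eval o t n (u (suc n))) →
              ∀ n → Eval o (consP h t) n (u n)
  eval-cons {h} {t} u head tail n = evComp (evPr evZ (eval-id n)) (eval-prec n)
    where
    eval-prec : ∀ n → Eval o (prec h (comp t (comp Fst Snd))) ⟨ 0 , n ⟩ (u n)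
    eval-prec zero    = evRec0 {x = 0} head
    eval-prec (suc n) = evRecS {x = 0} {n} (eval-prec n)
      (evComp (evComp (evSnd {a = 0} {⟨ n , u n ⟩}) (evFst {a = n} {u n})) (tail n))

relativize : Code → Code → Code
relativize Q Z          = Z
relativize Q S          = S
relativize Q Fst        = Fst
relativize Q Snd        = Snd
relativize Q Orc        = Q
relativize Q (comp f g) = comp (relativize Q f) (relativize Q g)
relativize Q (pr f g)   = pr (relativize Q f) (relativize Q g)
relativize Q (prec f g) = prec (relativize Q f) (relativize Q g)
relativize Q (mu f)     = mu (relativize Q f)

eval-relativize : ∀ {o o' Q} → (∀ x → Eval o Q x (o' x)) →
                  ∀ {c x y} → Eval o' c x y → Eval o (relativize Q c) x y
eval-relativize q evZ                  = evZ
eval-relativize q evS                  = evS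
eval-relativize q (evFst {a} {b})      = evFst {a = a} {b}
eval-relativize q (evSnd {a} {b})      = evSnd {a = a} {b}
eval-relativize q evOrc                = q _
eval-relativize q (evComp d d')        = evComp (eval-relativize q d) (eval-relativize q d')
eval-relativize q (evPr d d')          = evPr (eval-relativize q d) (eval-relativize q d')
eval-relativize q (evRec0 {x = x} d)   = evRec0 {x = x} (eval-relativize q d)
eval-relativize q (evRecS {x = x} {n} d d') =
  evRecS {x = x} {n} (eval-relativize q d) (eval-relativize q d')
eval-relativize q (evMu {x = x} {y} d below) =
  evMu {x = x} {y} (eval-relativize q d)
       (λ z z<y → proj₁ (below z z<y) , eval-relativize q (proj₂ (below z z<y)))

⊕-even : ∀ (g h : ℕ → ℕ) i → (g ⊕ h) (i + i) ≡ g i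
⊕-even g h zero    = refl
⊕-even g h (suc i) rewrite +-suc i i = ⊕-even (λ j → g (suc j)) (λ j → h (suc j)) i

⊕-odd : ∀ (g h : ℕ → ℕ) i → (g ⊕ h) (suc (i + i)) ≡ h i
⊕-odd g h zero    = refl
⊕-odd g h (suc i) rewrite +-suc i i = ⊕-odd (λ j → g (suc j)) (λ j → h (suc j)) i

module Simulation (X : ℕ → Bool) (ψ : Code) where

  readLeftP readRightP : Code
  readLeftP  = comp Orc (comp S (comp S doubleP))
  readRightP = comp Orc (comp S (comp S (comp S doubleP)))

  readXP : Code
  readXP = comp Snd readLeftP

  tailP : Code
  tailP = pr (comp (relativize readXP ψ) (pr (comp Fst readLeftP) (comp Fst readRightP))) readXP

  applyP : Code
  applyP = consP (comp Orc Z) tailP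

  -- The head codeOf applyP is read back from the oracle by applyP itself, so the
  -- program need not contain its own code.
  encode : ℕ → ℕ → ℕ
  encode u zero    = codeOf applyP
  encode u (suc k) = ⟨ u , χ X k ⟩

  module _ (u v : ℕ) where
    private
      o : ℕ → ℕ
      o = encode u ⊕ encode v

    eval-readLeft : ∀ n → Eval o readLeftP n (encode u (suc n))
    eval-readLeft n = subst (Eval o readLeftP n) (⊕-even _ _ n)
      (evComp (evComp (evComp (eval-double n) evS) evS) evOrc)

    eval-readRight : ∀ n → Eval o readRightP n (encode v (suc n))
    eval-readRight n = subst (Eval o readRightP n) (⊕-odd _ _ n)
      (evComp (evComp (evComp (evComp (eval-double n) evS) evS) evS) evOrc)

    eval-readX : ∀ n → Eval o readXP n (χ X n)
    eval-readX n = evComp (eval-readLeft n) (evSnd {a = u})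

  encode-app : ∀ {u v w} → Eval (χ X) ψ ⟨ u , v ⟩ w → K₂App (encode u) (encode v) (encode w)
  encode-app {u} {v} {w} run n =
    applyP , Codes-codeOf applyP , eval-cons (encode w) (evComp evZ evOrc) eval-tail n
    where
    eval-tail : ∀ n → Eval (encode u ⊕ encode v) tailP n (encode w (suc n))
    eval-tail n = evPr
      (evComp (evPr {y = u} {v} (evComp (eval-readLeft u v n) (evFst {a = u} {χ X n}))
                    (evComp (eval-readRight u v n) (evFst {a = v} {χ X n})))
              (eval-relativize (eval-readX u v) run))
      (eval-readX u v n)

  encode-computable : ∀ u → IsComputableIn X (encode u)
  encode-computable u = codeOf program , λ n →
    program , Codes-codeOf program ,
    eval-cons (encode u) (eval-const (codeOf applyP) 0) (λ n → evPr (eval-const u n) evOrc) n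
    where
    program : Code
    program = consP (constP (codeOf applyP)) (pr (constP u) Orc)

  encode-injective : ∀ {u v} → (∀ n → encode u n ≡ encode v n) → u ≡ v
  encode-injective eq = proj₁ (pair-injective (eq 1))

module Embedding (X : ℕ → Bool) (A : PCA) (N : PartialNumbering A)
                 (H : StronglyEffectivelyPCAValued X A N) where
  open PCA A
  open PartialNumbering N renaming (functional to γ-functional)

  e : ℕ
  e = proj₁ H

  ψ-defined : ∀ {n m a b c} → γ n a → γ m b → a · b ↓ c →
              ∃ λ y → Φ e (χ X) ⟨ n , m ⟩ y × γ y c
  ψ-defined = proj₁ (proj₂ H) _ _ _ _ _

  name : Carrier → ℕ
  name a = proj₁ (surjective a)

  γ-name : ∀ a → γ (name a) a
  γ-name a = proj₂ (surjective a)

  canonical-run : ∀ c → ∃ λ y → Φ e (χ X) ⟨ name (proj₁ (k-ax c c)) , name c ⟩ y × γ y c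
  canonical-run c with k-ax c c
  ... | kc , _ , kc·c↓c = ψ-defined (γ-name kc) (γ-name c) kc·c↓c

  canon : Carrier → ℕ
  canon c = proj₁ (canonical-run c)

  γ-canon : ∀ c → γ (canon c) c
  γ-canon c = proj₂ (proj₂ (canonical-run c))

  ψ-canon : ∀ {n m a b c y} → γ n a → γ m b → a · b ↓ c → Φ e (χ X) ⟨ n , m ⟩ y → y ≡ canon c
  ψ-canon {n} {m} {a} {b} {c} {y} γn γm a·b↓c run =
    proj₂ (proj₂ H) n m _ _ a b _ c c y (canon c) γn γm (γ-name _) (γ-name c)
      a·b↓c (proj₂ (proj₂ (k-ax c c))) run (proj₁ (proj₂ (canonical-run c)))

  -- e is only known to code a program once some application is defined, e.g. k k
  ψ-program : ∃ λ ψ → Codes e ψ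
  ψ-program with ψ-defined (γ-name k) (γ-name k) (proj₁ (proj₂ (k-ax k k)))
  ... | _ , (ψ , Codes-ψ , _) , _ = ψ , Codes-ψ

  ψ : Code
  ψ = proj₁ ψ-program

  eval-ψ-canon : ∀ {a b c} → a · b ↓ c → Eval (χ X) ψ ⟨ canon a , canon b ⟩ (canon c)
  eval-ψ-canon {a} {b} a·b↓c with ψ-defined (γ-canon a) (γ-canon b) a·b↓c
  ... | _ , run@(ψ' , Codes-ψ' , eval-ψ') , _ =
    subst₂ (λ p z → Eval (χ X) p ⟨ canon a , canon b ⟩ z)
      (Codes-functional Codes-ψ' (proj₂ ψ-program))
      (ψ-canon (γ-canon a) (γ-canon b) a·b↓c run)
      eval-ψ'

  open Simulation X ψ

  embed : Carrier → ℕ → ℕ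
  embed a = encode (canon a)

  embed-computable : ∀ a → IsComputableIn X (embed a)
  embed-computable a = encode-computable (canon a)

  embed-isEmbedding : IsEmbeddingK₂ A embed
  embed-isEmbedding = injective , λ _ _ _ a·b↓c → encode-app (eval-ψ-canon a·b↓c)
    where
    injective : ∀ a b → (∀ n → embed a n ≡ embed b n) → a ≡ b
    injective a b eq = γ-functional (γ-canon a)
      (subst (λ n → γ n b) (sym (encode-injective eq)) (γ-canon b))

theorem6p1 : (X : ℕ → Bool) (A : PCA) (N : PartialNumbering A) →
             StronglyEffectivelyPCAValued X A N →
             EmbedsInK₂^ X A × EmbedsInK₂ A
theorem6p1 X A N H = (embed , embed-computable , embed-isEmbedding) , (embed , embed-isEmbedding)
  where open Embedding X A N H
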